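{- Let $t,n$ be natural numbers such that $t>2$, $t<n/2$ and $\gcd(t,n)=1$, and let $K_t=2^{2t}-2^t+1$ be the Kasami exponent. Then $K_t$ is never congruent to $e(t+1,i)$ modulo $2^n-1$ for any $i<n$ with $\gcd(i,n)=1$.
   Context: For natural numbers $l,k$, $e(l,k)=\sum_{j=0}^{l-1}2^{jk}$. -}

module Defs where

open import Data.Nat using (ℕ; zero; suc; _+_; _*_; _∸_; _^_)
open import Data.Integer as ℤ using (ℤ; +_; _-_)
open import Data.Integer.Divisibility as ℤD using ()

e : ℕ → ℕ → ℕ
e zero    k = 0
e (suc l) k = e l k + 2 ^ (l * k)

-- Kasami exponent K_t = 2^{2t} - 2^t + 1  (2^{2t} ≥ 2^t, so truncated subtraction is exact)
K : ℕ → ℕ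
K t = 2 ^ (2 * t) ∸ 2 ^ t + 1

_≡_[mod_] : ℕ → ℕ → ℕ → Set
a ≡ b [mod m ] = (+ m) ℤD.∣ ((+ a) - (+ b))

-- In binary, K_t = 1 + 2^t + ⋯ + 2^(2t−1).  Modulo the Mersenne number M = 2ⁿ − 1 the exponents of
-- e(t+1, i) = Σ_{j≤t} 2^(ji) may be reduced mod n, and the reduced exponents ji mod n are distinct since
-- gcd(i, n) = 1.  Both sums are then sums of distinct powers of two below 2ⁿ, hence lie in [1, M], so the
-- congruence makes them equal, and uniqueness of binary expansions puts each ji mod n, 1 ≤ j ≤ t, into the
-- window [t, 2t).  Adding i to a residue in this window always overshoots n, so consecutive residues drop
-- by d = n − i ≥ 2; but t terms of such a progression do not fit into a window of length t.
module Submission where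

open import Data.Bool.Base using (Bool; true; false; if_then_else_; _∨_)
open import Data.Integer.Base using (∣_∣)
open import Data.Integer.Properties using (m-n≡m⊖n; ∣⊖∣-≤; ∣m⊖n∣≡∣n⊖m∣)
open import Data.List.Base using (List; []; _∷_; map; applyDownFrom)
open import Data.List.Membership.Propositional using (_∈_)
open import Data.List.Membership.Propositional.Properties using (∈-applyDownFrom⁺; ∈-applyDownFrom⁻)
open import Data.List.Properties using (map-applyDownFrom)
open import Data.List.Relation.Unary.All using (All; []; _∷_; lookup)
open import Data.List.Relation.Unary.All.Properties using (All¬⇒¬Any)
import Data.List.Relation.Unary.All.Properties as All
open import Data.List.Relation.Unary.Any using (here; there)
open import Data.List.Relation.Unary.Unique.Propositional using (Unique; []; _∷_)
import Data.List.Relation.Unary.Unique.Propositional.Properties as Unique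
open import Data.Nat.Base
open import Data.Nat.Coprimality using (Coprime; coprime-divisor; gcd≡1⇒coprime) renaming (sym to Coprime-sym)
open import Data.Nat.Divisibility using (_∣_; divides; ∣⇒≤)
open import Data.Nat.DivMod
open import Data.Nat.GCD using (gcd)
open import Data.Nat.ListAction using (sum)
open import Data.Nat.Properties
open import Data.List.Membership.DecPropositional _≟_ using (_∈?_)
open import Algebra.Properties.CommutativeSemigroup +-commutativeSemigroup using (xy∙z≈xz∙y; interchange)
open import Data.Product.Base using (_×_; _,_; proj₁; proj₂)
open import Data.Sum.Base using (_⊎_; inj₁; inj₂; [_,_]′)
open import Function.Base using (_∘_; const; id)
open import Relation.Binary.PropositionalEquality
open import Relation.Nullary using (¬_; does; yes; no; contradiction)
open import Relation.Nullary.Decidable using (dec-true; dec-false)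

open import Defs

digit : Bool → ℕ → ℕ
digit x k = if x then 2 ^ k else 0

fromBits : ℕ → (ℕ → Bool) → ℕ
fromBits zero    b = 0
fromBits (suc n) b = fromBits n b + digit (b n) n

fromBits<2^n : ∀ n b → fromBits n b < 2 ^ n
fromBits<2^n zero    b = z<s
fromBits<2^n (suc n) b = begin-strict
  fromBits n b + digit (b n) n <⟨ +-mono-<-≤ (fromBits<2^n n b) (digit≤2^n (b n)) ⟩
  2 ^ n + 2 ^ n                ≡⟨ cong (2 ^ n +_) (+-identityʳ (2 ^ n)) ⟨
  2 ^ suc n                    ∎
  where
  open ≤-Reasoning
  digit≤2^n : ∀ x → digit x n ≤ 2 ^ n
  digit≤2^n true  = ≤-refl
  digit≤2^n false = z≤n

+-digit-injective : ∀ {n a a′} x x′ → a < 2 ^ n → a′ < 2 ^ n →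
  a + digit x n ≡ a′ + digit x′ n → x ≡ x′ × a ≡ a′
+-digit-injective true  true  _   _    eq = refl , +-cancelʳ-≡ _ _ _ eq
+-digit-injective false false _   _    eq = refl , +-cancelʳ-≡ _ _ _ eq
+-digit-injective {n} {a} true false _ a′<2ⁿ eq =
  contradiction (subst (2 ^ n ≤_) (trans eq (+-identityʳ _)) (m≤n+m _ a)) (<⇒≱ a′<2ⁿ)
+-digit-injective {n} {a′ = a′} false true a<2ⁿ _ eq =
  contradiction (subst (2 ^ n ≤_) (trans (sym eq) (+-identityʳ _)) (m≤n+m _ a′)) (<⇒≱ a<2ⁿ)

fromBits-injective : ∀ n {b c} → fromBits n b ≡ fromBits n c → ∀ {k} → k < n → b k ≡ c k
fromBits-injective (suc n) {b} {c} eq k<1+n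
  with +-digit-injective {n} (b n) (c n) (fromBits<2^n n b) (fromBits<2^n n c) eq
     | m<1+n⇒m<n∨m≡n k<1+n
... | bn≡cn , _     | inj₂ refl = bn≡cn
... | _     , low≡ | inj₁ k<n  = fromBits-injective n low≡ k<n

fromBits-cong : ∀ n {b c} → (∀ {k} → k < n → b k ≡ c k) → fromBits n b ≡ fromBits n c
fromBits-cong zero    b≗c = refl
fromBits-cong (suc n) b≗c =
  cong₂ _+_ (fromBits-cong n (b≗c ∘ m<n⇒m<1+n)) (cong (λ x → digit x n) (b≗c (n<1+n n)))

fromBits-none : ∀ n → fromBits n (const false) ≡ 0
fromBits-none zero    = refl
fromBits-none (suc n) = trans (+-identityʳ _) (fromBits-none n)

fromBits-insert : ∀ n {k} b → k < n → b k ≡ false →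
  fromBits n (λ y → does (y ≟ k) ∨ b y) ≡ 2 ^ k + fromBits n b
fromBits-insert (suc n) {k} b k<1+n bk≡false with m<1+n⇒m<n∨m≡n k<1+n
... | inj₁ k<n rewrite dec-false (n ≟ k) (>⇒≢ k<n) = begin
  fromBits n _ + digit (b n) n          ≡⟨ cong (_+ digit (b n) n) (fromBits-insert n b k<n bk≡false) ⟩
  2 ^ k + fromBits n b + digit (b n) n  ≡⟨ +-assoc (2 ^ k) _ _ ⟩
  2 ^ k + fromBits (suc n) b            ∎
  where open ≡-Reasoning
... | inj₂ refl rewrite dec-true (k ≟ k) refl | bk≡false = begin
  fromBits k _ + 2 ^ k      ≡⟨ cong (_+ 2 ^ k) (fromBits-cong k (λ {y} y<k → cong (_∨ b y) (dec-false (y ≟ k) (<⇒≢ y<k)))) ⟩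
  fromBits k b + 2 ^ k      ≡⟨ +-comm (fromBits k b) _ ⟩
  2 ^ k + fromBits k b      ≡⟨ cong (2 ^ k +_) (+-identityʳ _) ⟨
  2 ^ k + (fromBits k b + 0) ∎
  where open ≡-Reasoning

sumPow2 : List ℕ → ℕ
sumPow2 xs = sum (map (2 ^_) xs)

sumPow2-∷-pos : ∀ x xs → 0 < sumPow2 (x ∷ xs)
sumPow2-∷-pos x xs = <-≤-trans (m^n>0 2 x) (m≤m+n (2 ^ x) (sumPow2 xs))

sumPow2≡fromBits : ∀ n {xs} → All (_< n) xs → Unique xs →
  sumPow2 xs ≡ fromBits n (λ y → does (y ∈? xs))
sumPow2≡fromBits n []                []             = sym (fromBits-none n)
sumPow2≡fromBits n {x ∷ xs} (x<n ∷ xs<n) (x∉xs ∷ uniq) = begin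
  2 ^ x + sumPow2 xs                            ≡⟨ cong (2 ^ x +_) (sumPow2≡fromBits n xs<n uniq) ⟩
  2 ^ x + fromBits n (λ y → does (y ∈? xs))     ≡⟨ fromBits-insert n _ x<n (dec-false (x ∈? xs) (All¬⇒¬Any x∉xs)) ⟨
  fromBits n (λ y → does (y ∈? x ∷ xs))         ∎
  where open ≡-Reasoning

sumPow2<2^n : ∀ n {xs} → All (_< n) xs → Unique xs → sumPow2 xs < 2 ^ n
sumPow2<2^n n xs<n uniq = subst (_< 2 ^ n) (sym (sumPow2≡fromBits n xs<n uniq)) (fromBits<2^n n _)

sumPow2-∈ : ∀ n {xs ys y} → All (_< n) xs → Unique xs → All (_< n) ys → Unique ys →
  sumPow2 xs ≡ sumPow2 ys → y ∈ ys → y ∈ xs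
sumPow2-∈ n {xs} {ys} {y} xs<n xs! ys<n ys! eq y∈ys
  with y ∈? xs
     | fromBits-injective n {λ z → does (z ∈? xs)}
         (trans (sym (sumPow2≡fromBits n xs<n xs!)) (trans eq (sumPow2≡fromBits n ys<n ys!)))
         (lookup ys<n y∈ys)
... | yes y∈xs | _       = y∈xs
... | no _     | false≡ = contradiction (trans false≡ (dec-true (y ∈? ys) y∈ys)) λ ()

sumPow2-applyDownFrom-+ : ∀ a l → sumPow2 (applyDownFrom (a +_) l) + 2 ^ a ≡ 2 ^ (a + l)
sumPow2-applyDownFrom-+ a zero    = cong (2 ^_) (sym (+-identityʳ a))
sumPow2-applyDownFrom-+ a (suc l) = begin
  2 ^ (a + l) + sumPow2 (applyDownFrom (a +_) l) + 2 ^ a   ≡⟨ +-assoc (2 ^ (a + l)) _ _ ⟩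
  2 ^ (a + l) + (sumPow2 (applyDownFrom (a +_) l) + 2 ^ a) ≡⟨ cong (2 ^ (a + l) +_) (sumPow2-applyDownFrom-+ a l) ⟩
  2 ^ (a + l) + 2 ^ (a + l)                                ≡⟨ cong (2 ^ (a + l) +_) (+-identityʳ _) ⟨
  2 ^ suc (a + l)                                          ≡⟨ cong (2 ^_) (+-suc a l) ⟨
  2 ^ (a + suc l)                                          ∎
  where open ≡-Reasoning

∣∸⇒%≡ : ∀ m {a b} .{{_ : NonZero m}} → b ≤ a → m ∣ a ∸ b → a % m ≡ b % m
∣∸⇒%≡ m {a} {b} b≤a m∣a∸b = trans (cong (_% m) (sym (m∸n+n≡m b≤a))) (%-remove-+ˡ b m∣a∸b)

%≡⇒∣∸ : ∀ m {a b} .{{_ : NonZero m}} → b ≤ a → a % m ≡ b % m → m ∣ a ∸ b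
%≡⇒∣∸ m {a} {b} _ a≡b = divides (a / m ∸ b / m) (begin
  a ∸ b                                   ≡⟨ cong₂ _∸_ (m≡m%n+[m/n]*n a m) (m≡m%n+[m/n]*n b m) ⟩
  a % m + a / m * m ∸ (b % m + b / m * m) ≡⟨ cong (λ r → a % m + a / m * m ∸ (r + b / m * m)) a≡b ⟨
  a % m + a / m * m ∸ (a % m + b / m * m) ≡⟨ [m+n]∸[m+o]≡n∸o (a % m) _ _ ⟩
  a / m * m ∸ b / m * m                   ≡⟨ *-distribʳ-∸ m (a / m) (b / m) ⟨
  (a / m ∸ b / m) * m                     ∎)
  where open ≡-Reasoning

≡[mod]⇒%≡ : ∀ {a b m} .{{_ : NonZero m}} → a ≡ b [mod m ] → a % m ≡ b % m
≡[mod]⇒%≡ {a} {b} {m} a≡b with subst (λ z → m ∣ ∣ z ∣) (m-n≡m⊖n a b) a≡b | ≤-total a b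
... | m∣∣a⊖b∣ | inj₁ a≤b = sym (∣∸⇒%≡ m a≤b (subst (m ∣_) (∣⊖∣-≤ a≤b) m∣∣a⊖b∣))
... | m∣∣a⊖b∣ | inj₂ b≤a = ∣∸⇒%≡ m b≤a (subst (m ∣_) (trans (∣m⊖n∣≡∣n⊖m∣ a b) (∣⊖∣-≤ b≤a)) m∣∣a⊖b∣)

%-*-one : ∀ m {x y} .{{_ : NonZero m}} → y % m ≡ 1 % m → (x * y) % m ≡ x % m
%-*-one m {x} {y} y≡1 = begin
  (x * y) % m                ≡⟨ %-distribˡ-* x y m ⟩
  ((x % m) * (y % m)) % m    ≡⟨ cong (λ z → ((x % m) * z) % m) y≡1 ⟩
  ((x % m) * (1 % m)) % m    ≡⟨ %-distribˡ-* x 1 m ⟨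
  (x * 1) % m                ≡⟨ cong (_% m) (*-identityʳ x) ⟩
  x % m                      ∎
  where open ≡-Reasoning

+-cong-% : ∀ m {a a′ b b′} .{{_ : NonZero m}} → a % m ≡ a′ % m → b % m ≡ b′ % m →
  (a + b) % m ≡ (a′ + b′) % m
+-cong-% m {a} {a′} {b} {b′} a≡a′ b≡b′ =
  trans (%-distribˡ-+ a b m) (trans (cong₂ (λ x y → (x + y) % m) a≡a′ b≡b′) (sym (%-distribˡ-+ a′ b′ m)))

%-injective-[1,m] : ∀ {a b m} .{{_ : NonZero m}} → 0 < a → a ≤ m → 0 < b → b ≤ m →
  a % m ≡ b % m → a ≡ b
%-injective-[1,m] {a} {b} {m} 0<a a≤m 0<b b≤m a≡b with m≤n⇒m<n∨m≡n a≤m | m≤n⇒m<n∨m≡n b≤m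
... | inj₁ a<m | inj₁ b<m  = trans (sym (m<n⇒m%n≡m a<m)) (trans a≡b (m<n⇒m%n≡m b<m))
... | inj₂ a≡m | inj₂ b≡m  = trans a≡m (sym b≡m)
... | inj₁ a<m | inj₂ refl = contradiction (trans (sym (m<n⇒m%n≡m a<m)) (trans a≡b (n%n≡0 m))) (>⇒≢ 0<a)
... | inj₂ refl | inj₁ b<m = contradiction (trans (sym (m<n⇒m%n≡m b<m)) (trans (sym a≡b) (n%n≡0 m))) (>⇒≢ 0<b)

%-wraps-once : ∀ {a n} .{{_ : NonZero n}} → a % n < a → a < n + n → a % n + n ≡ a
%-wraps-once {a} {n} a%n<a a<2n with n ≤? a
... | no  n≰a = contradiction (m<n⇒m%n≡m (≰⇒> n≰a)) (<⇒≢ a%n<a)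
... | yes n≤a = begin
  a % n + n        ≡⟨ cong (_+ n) (m≤n⇒[n∸m]%m≡n%m n≤a) ⟨
  (a ∸ n) % n + n  ≡⟨ cong (_+ n) (m<n⇒m%n≡m (m<n+o⇒m∸n<o a n a<2n)) ⟩
  a ∸ n + n        ≡⟨ m∸n+n≡m n≤a ⟩
  a                ∎
  where open ≡-Reasoning

*-%-distinct : ∀ {n i j k} .{{_ : NonZero n}} → Coprime n i → j < k → k < n → k * i % n ≢ j * i % n
*-%-distinct {n} {i} {j} {k} n⊥i j<k k<n ki≡ji = <⇒≱ (≤-<-trans (m∸n≤m k j) k<n) (∣⇒≤ ⦃ k∸j≢0 ⦄ n∣k∸j)
  where
  k∸j≢0 : NonZero (k ∸ j)
  k∸j≢0 = >-nonZero (m<n⇒0<n∸m j<k)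
  n∣k∸j : n ∣ k ∸ j
  n∣k∸j = coprime-divisor n⊥i (subst (n ∣_) (trans (sym (*-distribʳ-∸ i k j)) (*-comm (k ∸ j) i))
                                     (%≡⇒∣∸ n (*-monoˡ-≤ i (<⇒≤ j<k)) ki≡ji))

e≡sumPow2 : ∀ l k → e l k ≡ sumPow2 (applyDownFrom (_* k) l)
e≡sumPow2 zero    k = refl
e≡sumPow2 (suc l) k = trans (+-comm (e l k) _) (cong (2 ^ (l * k) +_) (e≡sumPow2 l k))

multiplesMod : (n i l : ℕ) .{{_ : NonZero n}} → List ℕ
multiplesMod n i l = applyDownFrom (λ j → j * i % n) l

multiplesMod-below : ∀ {n} i l .{{_ : NonZero n}} → All (_< n) (multiplesMod n i l)
multiplesMod-below {n} i l = All.applyDownFrom⁺₁ _ l (λ {j} _ → m%n<n (j * i) n)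

multiplesMod-unique : ∀ {n i l} .{{_ : NonZero n}} → Coprime n i → l ≤ n → Unique (multiplesMod n i l)
multiplesMod-unique {l = l} n⊥i l≤n =
  Unique.applyDownFrom⁺₁ _ l (λ j<k k<l → *-%-distinct n⊥i j<k (<-≤-trans k<l l≤n))

module Mersenne (n : ℕ) .{{_ : NonZero n}} .{{_ : NonZero (2 ^ n ∸ 1)}} where

  M : ℕ
  M = 2 ^ n ∸ 1

  2^n%M≡1 : 2 ^ n % M ≡ 1 % M
  2^n%M≡1 = trans (cong (_% M) 2^n≡1+M) ([m+n]%n≡m%n 1 M)
    where
    2^n≡1+M : 2 ^ n ≡ 1 + M
    2^n≡1+M = trans (sym (m∸n+n≡m (m^n>0 2 n))) (+-comm M 1)

  2^[q*n]%M≡1 : ∀ q → 2 ^ (q * n) % M ≡ 1 % M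
  2^[q*n]%M≡1 zero    = refl
  2^[q*n]%M≡1 (suc q) = begin
    2 ^ (n + q * n) % M        ≡⟨ cong (_% M) (^-distribˡ-+-* 2 n (q * n)) ⟩
    (2 ^ n * 2 ^ (q * n)) % M  ≡⟨ %-*-one M (2^[q*n]%M≡1 q) ⟩
    2 ^ n % M                  ≡⟨ 2^n%M≡1 ⟩
    1 % M                      ∎
    where open ≡-Reasoning

  2^m%M≡2^[m%n]%M : ∀ m → 2 ^ m % M ≡ 2 ^ (m % n) % M
  2^m%M≡2^[m%n]%M m = begin
    2 ^ m % M                             ≡⟨ cong (λ k → 2 ^ k % M) (m≡m%n+[m/n]*n m n) ⟩
    2 ^ (m % n + m / n * n) % M           ≡⟨ cong (_% M) (^-distribˡ-+-* 2 (m % n) _) ⟩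
    (2 ^ (m % n) * 2 ^ (m / n * n)) % M   ≡⟨ %-*-one M (2^[q*n]%M≡1 (m / n)) ⟩
    2 ^ (m % n) % M                       ∎
    where open ≡-Reasoning

  sumPow2%M : ∀ xs → sumPow2 xs % M ≡ sumPow2 (map (_% n) xs) % M
  sumPow2%M []       = refl
  sumPow2%M (x ∷ xs) = +-cong-% M (2^m%M≡2^[m%n]%M x) (sumPow2%M xs)

  <2^n⇒≤M : ∀ {a} → a < 2 ^ n → a ≤ M
  <2^n⇒≤M {a} a<2^n = m+n≤o⇒m≤o∸n a (subst (_≤ 2 ^ n) (+-comm 1 a) a<2^n)

  sumPow2-%M-injective : ∀ {x xs y ys} → All (_< n) (x ∷ xs) → Unique (x ∷ xs) →
    All (_< n) (y ∷ ys) → Unique (y ∷ ys) →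
    sumPow2 (x ∷ xs) % M ≡ sumPow2 (y ∷ ys) % M → sumPow2 (x ∷ xs) ≡ sumPow2 (y ∷ ys)
  sumPow2-%M-injective {x} {xs} {y} {ys} xs<n xs! ys<n ys! =
    %-injective-[1,m] (sumPow2-∷-pos x xs) (<2^n⇒≤M (sumPow2<2^n n xs<n xs!))
                      (sumPow2-∷-pos y ys) (<2^n⇒≤M (sumPow2<2^n n ys<n ys!))

  e%M : ∀ l k → e l k % M ≡ sumPow2 (multiplesMod n k l) % M
  e%M l k = begin
    e l k % M                                              ≡⟨ cong (_% M) (e≡sumPow2 l k) ⟩
    sumPow2 (applyDownFrom (_* k) l) % M                   ≡⟨ sumPow2%M (applyDownFrom (_* k) l) ⟩
    sumPow2 (map (_% n) (applyDownFrom (_* k) l)) % M      ≡⟨ cong (λ xs → sumPow2 xs % M) (map-applyDownFrom (_* k) (_% n) l) ⟩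
    sumPow2 (multiplesMod n k l) % M                       ∎
    where open ≡-Reasoning

kasamiDigits : ℕ → List ℕ
kasamiDigits t = 0 ∷ applyDownFrom (t +_) t

K≡sumPow2 : ∀ t → K t ≡ sumPow2 (kasamiDigits t)
K≡sumPow2 t = begin
  2 ^ (t + (t + 0)) ∸ 2 ^ t + 1  ≡⟨ cong (λ m → 2 ^ (t + m) ∸ 2 ^ t + 1) (+-identityʳ t) ⟩
  2 ^ (t + t) ∸ 2 ^ t + 1        ≡⟨ cong (λ m → m ∸ 2 ^ t + 1) (sumPow2-applyDownFrom-+ t t) ⟨
  S + 2 ^ t ∸ 2 ^ t + 1          ≡⟨ cong (_+ 1) (m+n∸n≡m S (2 ^ t)) ⟩
  S + 1                          ≡⟨ +-comm S 1 ⟩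
  1 + S                          ∎
  where
  open ≡-Reasoning
  S = sumPow2 (applyDownFrom (t +_) t)

kasamiDigits-unique : ∀ {t} → 0 < t → Unique (kasamiDigits t)
kasamiDigits-unique {t} 0<t =
  All.applyDownFrom⁺₁ (t +_) t (λ {j} _ → <⇒≢ (<-≤-trans 0<t (m≤m+n t j)))
  ∷ Unique.applyDownFrom⁺₁ (t +_) t (λ j<i _ → >⇒≢ j<i ∘ +-cancelˡ-≡ t _ _)

kasamiDigits-below : ∀ {t n} → 0 < t → t + t ≤ n → All (_< n) (kasamiDigits t)
kasamiDigits-below {t} 0<t t+t≤n =
  <-≤-trans 0<t (≤-trans (m≤m+n t t) t+t≤n)
  ∷ All.applyDownFrom⁺₁ (t +_) t (λ j<t → <-≤-trans (+-monoʳ-< t j<t) t+t≤n)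

∈-kasamiDigits⁻ : ∀ {t y} → y ∈ kasamiDigits t → y ≡ 0 ⊎ (t ≤ y × y < t + t)
∈-kasamiDigits⁻ (here y≡0) = inj₁ y≡0
∈-kasamiDigits⁻ {t} (there y∈) with ∈-applyDownFrom⁻ (t +_) y∈
... | j , j<t , refl = inj₂ (m≤m+n t j , +-monoʳ-< t j<t)

descending-progression : ∀ {t i d} (y : ℕ → ℕ) → y 0 ≡ i →
  (∀ {j} → suc j < t → y (suc j) + (i + d) ≡ i + y j) →
  ∀ {j} → j < t → y j + j * d ≡ i
descending-progression y y0≡i step {zero}  _      = trans (+-identityʳ (y 0)) y0≡i
descending-progression {t} {i} {d} y y0≡i step {suc j} 1+j<t = +-cancelʳ-≡ (i + d) _ _ (begin
  y (suc j) + (d + j * d) + (i + d)  ≡⟨ xy∙z≈xz∙y (y (suc j)) _ _ ⟩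
  y (suc j) + (i + d) + (d + j * d)  ≡⟨ cong (_+ (d + j * d)) (step 1+j<t) ⟩
  i + y j + (d + j * d)              ≡⟨ interchange i (y j) d (j * d) ⟩
  i + d + (y j + j * d)              ≡⟨ +-comm (i + d) _ ⟩
  y j + j * d + (i + d)              ≡⟨ cong (_+ (i + d)) (descending-progression y y0≡i step (<-trans (n<1+n j) 1+j<t)) ⟩
  i + (i + d)                        ∎)
  where open ≡-Reasoning

progression-too-long : ∀ {s y i d} → 1 ≤ s → 2 ≤ d → suc s ≤ y → i < suc s + suc s → y + s * d ≢ i
progression-too-long {s} {y} {i} {d} 1≤s 2≤d 1+s≤y i<2+2s y+sd≡i = <⇒≱ 2s<1+s 1+s≤2s
  where
  2s≡s*2 : s + s ≡ s * 2
  2s≡s*2 = trans (cong (s +_) (sym (+-identityʳ s))) (*-comm 2 s)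
  1+s≤2s : suc s ≤ s * 2
  1+s≤2s = subst (suc s ≤_) 2s≡s*2 (+-monoˡ-≤ s 1≤s)
  2s<1+s : s * 2 < suc s
  2s<1+s = +-cancelˡ-< (suc s) _ _ (begin-strict
    suc s + s * 2  ≤⟨ +-mono-≤ 1+s≤y (*-monoʳ-≤ s 2≤d) ⟩
    y + s * d      ≡⟨ y+sd≡i ⟩
    i              <⟨ i<2+2s ⟩
    suc s + suc s  ∎)
    where open ≤-Reasoning

multiples-leave-window : ∀ {t n i} .{{_ : NonZero n}} → 2 ≤ t → t + t < n → i < n →
  ¬ (∀ {j} → 0 < j → j ≤ t → t ≤ j * i % n × j * i % n < t + t)
multiples-leave-window {suc s} {n} {i} (s≤s 1≤s) 2t<n i<n inWindow
  with m≤n⇒∃[o]m+o≡n (<⇒≤ i<n)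
... | d , refl = progression-too-long 1≤s 2≤d (proj₁ (y-window ≤-refl)) i<2t
                   (descending-progression y y0≡i wrap ≤-refl)
  where
  t = suc s
  y : ℕ → ℕ
  y j = suc j * i % (i + d)
  y-window : ∀ {j} → j < t → t ≤ y j × y j < t + t
  y-window = inWindow z<s
  y0≡i : y 0 ≡ i
  y0≡i = trans (cong (_% (i + d)) (+-identityʳ i)) (m<n⇒m%n≡m i<n)
  i<2t : i < t + t
  i<2t = subst (_< t + t) y0≡i (proj₂ (y-window z<s))
  2≤d : 2 ≤ d
  2≤d = +-cancelˡ-≤ i 2 d (subst (_≤ i + d) (+-comm 2 i) (≤-trans (s≤s i<2t) 2t<n))
  wrap : ∀ {j} → suc j < t → y (suc j) + (i + d) ≡ i + y j
  wrap {j} 1+j<t = trans (cong (_+ (i + d)) y[1+j]≡[i+yj]%n) (%-wraps-once wrapped (+-mono-< i<n (m%n<n _ _)))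
    where
    y[1+j]≡[i+yj]%n : y (suc j) ≡ (i + y j) % (i + d)
    y[1+j]≡[i+yj]%n = +-cong-% (i + d) refl (sym (m%n%n≡m%n (suc j * i) (i + d)))
    wrapped : (i + y j) % (i + d) < i + y j
    wrapped = begin-strict
      (i + y j) % (i + d)  ≡⟨ y[1+j]≡[i+yj]%n ⟨
      y (suc j)            <⟨ proj₂ (y-window 1+j<t) ⟩
      t + t                ≤⟨ +-mono-≤ (subst (t ≤_) y0≡i (proj₁ (y-window z<s))) (proj₁ (y-window (<-trans (n<1+n j) 1+j<t))) ⟩
      i + y j              ∎
      where open ≤-Reasoning

multiples-in-window : ∀ {t n i} .{{_ : NonZero n}} → 0 < t → t + t < n → Coprime n i →
  sumPow2 (kasamiDigits t) ≡ sumPow2 (multiplesMod n i (suc t)) →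
  ∀ {j} → 0 < j → j ≤ t → t ≤ j * i % n × j * i % n < t + t
multiples-in-window {t} {n} {i} 0<t t+t<n n⊥i same-sum {j} 0<j j≤t =
  [ (λ ji%n≡0 → contradiction (trans ji%n≡0 (sym (m<n⇒m%n≡m (>-nonZero⁻¹ n))))
                              (*-%-distinct n⊥i 0<j (≤-<-trans j≤t t<n)))
  , id ]′ (∈-kasamiDigits⁻ ji%n∈kasamiDigits)
  where
  t<n : t < n
  t<n = ≤-<-trans (m≤m+n t t) t+t<n
  ji%n∈kasamiDigits : j * i % n ∈ kasamiDigits t
  ji%n∈kasamiDigits = sumPow2-∈ n (kasamiDigits-below 0<t (<⇒≤ t+t<n)) (kasamiDigits-unique 0<t)
    (multiplesMod-below i (suc t)) (multiplesMod-unique n⊥i t<n) same-sum (∈-applyDownFrom⁺ _ (s≤s j≤t))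

theorem4 : (t n : ℕ) → 2 < t → 2 * t < n → gcd t n ≡ 1 →
    (i : ℕ) → i < n → gcd i n ≡ 1 →
    ¬ (K t ≡ e (t + 1) i [mod (2 ^ n ∸ 1) ])
theorem4 t n@(suc _) 2<t 2t<n _ i i<n gcd[i,n]≡1 K≡e =
  multiples-leave-window (<⇒≤ 2<t) t+t<n i<n (multiples-in-window 0<t t+t<n n⊥i same-sum)
  where
  instance
    M≢0 : NonZero (2 ^ n ∸ 1)
    M≢0 = >-nonZero (m<n⇒0<n∸m (^-monoʳ-≤ 2 {1} {n} (s≤s z≤n)))
  open Mersenne n
  t+t<n : t + t < n
  t+t<n = subst (_< n) (cong (t +_) (+-identityʳ t)) 2t<n
  0<t : 0 < t
  0<t = <-trans z<s 2<t
  n⊥i : Coprime n i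
  n⊥i = Coprime-sym (gcd≡1⇒coprime gcd[i,n]≡1)
  same-sum : sumPow2 (kasamiDigits t) ≡ sumPow2 (multiplesMod n i (suc t))
  same-sum = sumPow2-%M-injective (kasamiDigits-below 0<t (<⇒≤ t+t<n)) (kasamiDigits-unique 0<t)
    (multiplesMod-below i (suc t)) (multiplesMod-unique n⊥i (≤-<-trans (m≤m+n t t) t+t<n)) (begin
      sumPow2 (kasamiDigits t) % M  ≡⟨ cong (_% M) (K≡sumPow2 t) ⟨
      K t % M                        ≡⟨ ≡[mod]⇒%≡ K≡e ⟩
      e (t + 1) i % M                ≡⟨ cong (λ l → e l i % M) (+-comm t 1) ⟩
      e (suc t) i % M                ≡⟨ e%M (suc t) i ⟩
      sumPow2 (multiplesMod n i (suc t)) % M ∎)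
    where open ≡-Reasoning
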